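{- Let $\mathcal{SP}$ be the class of split graphs and $k\ge 0$ an integer. For all integers $i,j\geq 2k+3$, we have $R_k^{\mathcal{SP}}(i,j)=i+j-1$.
   Context: All graphs are finite and simple. A graph is split if its vertex set can be partitioned into a clique and an independent set. For a graph $G$ and an integer $k\ge 0$, a $k$-sparse $j$-set is a set of exactly $j$ vertices of $G$ inducing a subgraph of maximum degree at most $k$; a $k$-dense $i$-set is a set of exactly $i$ vertices that is $k$-sparse in the complement of $G$. For a graph class $\mathcal{G}$, $R_k^{\mathcal{G}}(i,j)$ is the smallest natural number $n$ such that every graph on $n$ vertices in $\mathcal{G}$ has a $k$-dense $i$-set or a $k$-sparse $j$-set. -}

module Defs where

open import Data.Nat using (ℕ; _≤_; _<_)
open import Data.Bool using (Bool; true; false; not; _∧_)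
open import Data.Fin using (Fin; _≟_)
open import Data.Fin.Subset using (Subset; _∈_; _∩_; ∣_∣)
open import Data.Vec using (tabulate)
open import Data.Product using (Σ; _×_)
open import Relation.Binary.PropositionalEquality using (_≡_; _≢_)
open import Relation.Nullary using (¬_)
open import Relation.Nullary.Decidable using (isYes)

record Graph (n : ℕ) : Set where
  field
    adj    : Fin n → Fin n → Bool
    sym    : ∀ u v → adj u v ≡ adj v u
    irrefl : ∀ v → adj v v ≡ false
open Graph public

complement : ∀ {n} → Graph n → Graph n
complement {n} G = record
  { adj    = λ u v → not (adj G u v) ∧ not (isYes (u ≟ v))
  ; sym    = symc
  ; irrefl = irc
  }
  where
  open import Relation.Binary.PropositionalEquality using (refl; cong₂; cong)
  open import Relation.Nullary using (yes; no)
  open import Relation.Binary.PropositionalEquality using (sym)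
  symc : ∀ u v → (not (adj G u v) ∧ not (isYes (u ≟ v))) ≡ (not (adj G v u) ∧ not (isYes (v ≟ u)))
  symc u v with u ≟ v | v ≟ u
  ... | yes _ | yes _ = cong₂ _∧_ (cong not (Graph.sym G u v)) refl
  ... | no _  | no _  = cong₂ _∧_ (cong not (Graph.sym G u v)) refl
  ... | yes refl | no p = Data.Empty.⊥-elim (p refl)
    where import Data.Empty
  ... | no p | yes refl = Data.Empty.⊥-elim (p refl)
    where import Data.Empty
  irc : ∀ v → (not (adj G v v) ∧ not (isYes (v ≟ v))) ≡ false
  irc v with v ≟ v
  ... | yes _ = Data.Bool.Properties.∧-zeroʳ (not (adj G v v))
    where import Data.Bool.Properties
  ... | no p = Data.Empty.⊥-elim (p refl)
    where import Data.Empty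

IsSplit : ∀ {n} → Graph n → Set
IsSplit {n} G = Σ (Fin n → Bool) λ C →
  (∀ u v → u ≢ v → C u ≡ true → C v ≡ true → adj G u v ≡ true) ×
  (∀ u v → C u ≡ false → C v ≡ false → adj G u v ≡ false)

nbhd : ∀ {n} → Graph n → Fin n → Subset n
nbhd G v = tabulate (adj G v)

SparseSet : ∀ {n} → Graph n → ℕ → ℕ → Subset n → Set
SparseSet G k j S = (∣ S ∣ ≡ j) × (∀ v → v ∈ S → ∣ S ∩ nbhd G v ∣ ≤ k)

DenseSet : ∀ {n} → Graph n → ℕ → ℕ → Subset n → Set
DenseSet G k i S = SparseSet (complement G) k i S

RamseyProp : ℕ → ℕ → ℕ → ℕ → Set
RamseyProp k i j n = (G : Graph n) → IsSplit G →
  Σ (Subset n) (DenseSet G k i) ⊎' Σ (Subset n) (SparseSet G k j)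
  where open import Data.Sum renaming (_⊎_ to _⊎'_)

SplitRamseyIs : ℕ → ℕ → ℕ → ℕ → Set
SplitRamseyIs k i j n = RamseyProp k i j n × (∀ m → m < n → ¬ RamseyProp k i j m)

-- Upper bound: the clique part of a split graph on i + j - 1 vertices has at least i vertices or
-- its independent part has at least j, and these are 0-dense resp. 0-sparse.
-- Lower bound: take a clique K of size a = i - 1 and an independent set I of size b = j - 1,
-- joined so that every vertex of K has c = k + 1 neighbours in I and every vertex of I has
-- c non-neighbours in K (possible as a, b ≥ 2c). A j-set S must meet K, and a vertex u of S ∩ K
-- has at least a + k neighbours among the a + b vertices, so u has at least j + (a + k) - (a + b)
-- = k + 1 neighbours in S. Dually no i-set is k-dense. Deleting a vertex shows that the Ramsey
-- property is upward closed in the number of vertices.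
module Submission where

open import Defs hiding (sym)
open import Data.Nat using (ℕ; zero; suc; _+_; _∸_; _*_; _≤_; _<_; _≤′_; ≤′-reflexive; ≤′-step; z≤n; s≤s; s≤s⁻¹; _≤?_; _<?_)
open import Data.Nat.Properties
open import Data.Nat.Tactic.RingSolver using (solve-∀)
open import Data.Bool using (Bool; true; false; not; _∧_; _∨_; _xor_)
open import Data.Bool.Properties using (∧-zeroʳ; ∧-identityʳ; ∧-comm; xor-comm; ¬-not)
open import Data.Fin as Fin using (Fin; toℕ)
import Data.Fin.Properties as Fin
open import Data.Fin.Subset using (Subset; inside; outside; _∈_; _∉_; _∩_; _∪_; ∣_∣; _⊆_; ⊥; ⁅_⁆; ∁; Nonempty; Empty)
open import Data.Fin.Subset.Properties
open import Data.Vec using ([]; _∷_; tabulate; here; there)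
open import Data.Vec.Properties using (tabulate-cong; lookup∘tabulate; []=⇒lookup; lookup⇒[]=)
open import Data.Product using (Σ; _×_; _,_; proj₁; proj₂)
open import Data.Sum using (inj₁; inj₂)
open import Function using (id; _∘_; mk⇔)
open import Relation.Binary.PropositionalEquality
open import Relation.Nullary using (¬_; Dec; yes; no; does; contradiction)
open import Relation.Nullary.Decidable using (isYes; isYes≗does; dec-true; dec-false; does-⇔; ⌊⌋-map′)

∣p∪q∣+∣p∩q∣≡∣p∣+∣q∣ : ∀ {n} (p q : Subset n) → ∣ p ∪ q ∣ + ∣ p ∩ q ∣ ≡ ∣ p ∣ + ∣ q ∣
∣p∪q∣+∣p∩q∣≡∣p∣+∣q∣ [] [] = refl
∣p∪q∣+∣p∩q∣≡∣p∣+∣q∣ (inside ∷ p) (inside ∷ q) = cong suc (begin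
  ∣ p ∪ q ∣ + suc ∣ p ∩ q ∣ ≡⟨ +-suc ∣ p ∪ q ∣ ∣ p ∩ q ∣ ⟩
  suc (∣ p ∪ q ∣ + ∣ p ∩ q ∣) ≡⟨ cong suc (∣p∪q∣+∣p∩q∣≡∣p∣+∣q∣ p q) ⟩
  suc (∣ p ∣ + ∣ q ∣) ≡⟨ +-suc ∣ p ∣ ∣ q ∣ ⟨
  ∣ p ∣ + suc ∣ q ∣ ∎)
  where open ≡-Reasoning
∣p∪q∣+∣p∩q∣≡∣p∣+∣q∣ (inside ∷ p) (outside ∷ q) = cong suc (∣p∪q∣+∣p∩q∣≡∣p∣+∣q∣ p q)
∣p∪q∣+∣p∩q∣≡∣p∣+∣q∣ (outside ∷ p) (inside ∷ q) =
  trans (cong suc (∣p∪q∣+∣p∩q∣≡∣p∣+∣q∣ p q)) (sym (+-suc ∣ p ∣ ∣ q ∣))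
∣p∪q∣+∣p∩q∣≡∣p∣+∣q∣ (outside ∷ p) (outside ∷ q) = ∣p∪q∣+∣p∩q∣≡∣p∣+∣q∣ p q

∣p∪q∣≤∣p∣+∣q∣ : ∀ {n} (p q : Subset n) → ∣ p ∪ q ∣ ≤ ∣ p ∣ + ∣ q ∣
∣p∪q∣≤∣p∣+∣q∣ p q = ≤-trans (m≤m+n ∣ p ∪ q ∣ ∣ p ∩ q ∣) (≤-reflexive (∣p∪q∣+∣p∩q∣≡∣p∣+∣q∣ p q))

n+m<∣p∣+∣q∣⇒m<∣p∩q∣ : ∀ {n m} (p q : Subset n) → n + m < ∣ p ∣ + ∣ q ∣ → m < ∣ p ∩ q ∣
n+m<∣p∣+∣q∣⇒m<∣p∩q∣ {n} {m} p q n+m<∣p∣+∣q∣ = +-cancelˡ-< n m ∣ p ∩ q ∣ (begin-strict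
  n + m                     <⟨ n+m<∣p∣+∣q∣ ⟩
  ∣ p ∣ + ∣ q ∣             ≡⟨ ∣p∪q∣+∣p∩q∣≡∣p∣+∣q∣ p q ⟨
  ∣ p ∪ q ∣ + ∣ p ∩ q ∣     ≤⟨ +-monoˡ-≤ ∣ p ∩ q ∣ (∣p∣≤n (p ∪ q)) ⟩
  n + ∣ p ∩ q ∣             ∎)
  where open ≤-Reasoning

Empty⇒∣p∣≡0 : ∀ {n} {p : Subset n} → Empty p → ∣ p ∣ ≡ 0
Empty⇒∣p∣≡0 {n} empty = trans (cong ∣_∣ (Empty-unique empty)) (∣⊥∣≡0 n)

0<∣p∣⇒Nonempty : ∀ {n} {p : Subset n} → 0 < ∣ p ∣ → Nonempty p
0<∣p∣⇒Nonempty {p = p} 0<∣p∣ with nonempty? p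
... | yes nonempty = nonempty
... | no empty = contradiction (Empty⇒∣p∣≡0 empty) (>⇒≢ 0<∣p∣)

∃-subset-of-size : ∀ {n} (p : Subset n) m → m ≤ ∣ p ∣ → Σ (Subset n) λ q → q ⊆ p × ∣ q ∣ ≡ m
∃-subset-of-size {n} p zero _ = ⊥ , (λ x∈⊥ → contradiction x∈⊥ ∉⊥) , ∣⊥∣≡0 n
∃-subset-of-size (inside ∷ p) (suc m) (s≤s m≤∣p∣) with ∃-subset-of-size p m m≤∣p∣
... | q , q⊆p , ∣q∣≡m = inside ∷ q , in⊆in q⊆p , cong suc ∣q∣≡m
∃-subset-of-size (outside ∷ p) (suc m) m<∣p∣ with ∃-subset-of-size p (suc m) m<∣p∣
... | q , q⊆p , ∣q∣≡m = outside ∷ q , s⊆s q⊆p , ∣q∣≡m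

∈-tabulate⁻ : ∀ {n} (f : Fin n → Bool) {v} → v ∈ tabulate f → f v ≡ true
∈-tabulate⁻ f {v} v∈ = trans (sym (lookup∘tabulate f v)) ([]=⇒lookup v∈)

∈-tabulate⁺ : ∀ {n} (f : Fin n → Bool) {v} → f v ≡ true → v ∈ tabulate f
∈-tabulate⁺ f {v} fv≡true = lookup⇒[]= v (tabulate f) (trans (lookup∘tabulate f v) fv≡true)

interval : ∀ {n} (start length : ℕ) → Subset n
interval {zero}  _        _       = []
interval {suc n} zero     zero    = ⊥
interval {suc n} zero     (suc m) = inside ∷ interval zero m
interval {suc n} (suc lo) m       = outside ∷ interval lo m

∣interval∣ : ∀ {n} lo m → lo + m ≤ n → ∣ interval {n} lo m ∣ ≡ m
∣interval∣ {zero}  lo       m       lo+m≤0       = sym (n≤0⇒n≡0 (≤-trans (m≤n+m m lo) lo+m≤0))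
∣interval∣ {suc n} zero     zero    _            = ∣⊥∣≡0 (suc n)
∣interval∣ {suc n} zero     (suc m) (s≤s m≤n)    = cong suc (∣interval∣ zero m m≤n)
∣interval∣ {suc n} (suc lo) m       (s≤s lo+m≤n) = ∣interval∣ lo m lo+m≤n

∈-interval⁻ : ∀ {n lo m} {v : Fin n} → v ∈ interval lo m → lo ≤ toℕ v × toℕ v < lo + m
∈-interval⁻ {suc n} {zero}   {zero}  v∈⊥          = contradiction v∈⊥ ∉⊥
∈-interval⁻ {suc n} {zero}   {suc m} {Fin.zero}    here = z≤n , s≤s z≤n
∈-interval⁻ {suc n} {zero}   {suc m} {Fin.suc v} (there v∈) = z≤n , s≤s (proj₂ (∈-interval⁻ v∈))
∈-interval⁻ {suc n} {suc lo} {m}     {Fin.suc v} (there v∈) with ∈-interval⁻ v∈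
... | lo≤v , v<lo+m = s≤s lo≤v , s≤s v<lo+m

isYes-≟-false : ∀ {n} {u v : Fin n} → u ≢ v → isYes (u Fin.≟ v) ≡ false
isYes-≟-false {u = u} {v} u≢v = trans (isYes≗does (u Fin.≟ v)) (dec-false (u Fin.≟ v) u≢v)

isYes-≟-sym : ∀ {n} (u v : Fin n) → isYes (u Fin.≟ v) ≡ isYes (v Fin.≟ u)
isYes-≟-sym u v = begin
  isYes (u Fin.≟ v) ≡⟨ isYes≗does (u Fin.≟ v) ⟩
  does (u Fin.≟ v)  ≡⟨ does-⇔ (mk⇔ sym sym) (u Fin.≟ v) (v Fin.≟ u) ⟩
  does (v Fin.≟ u)  ≡⟨ isYes≗does (v Fin.≟ u) ⟨
  isYes (v Fin.≟ u) ∎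
  where open ≡-Reasoning

module _ {n} (G : Graph n) where

  complement-adj : ∀ {u v} → u ≢ v → adj (complement G) u v ≡ not (adj G u v)
  complement-adj {u} {v} u≢v =
    trans (cong (λ b → not (adj G u v) ∧ not b) (isYes-≟-false u≢v)) (∧-identityʳ _)

  complement-nonadjacent : ∀ {u v} → (u ≢ v → adj G u v ≡ true) → adj (complement G) u v ≡ false
  complement-nonadjacent {u} {v} adjacent = by-cases (u Fin.≟ v)
    where
    by-cases : Dec (u ≡ v) → adj (complement G) u v ≡ false
    by-cases (yes refl) = irrefl (complement G) u
    by-cases (no u≢v) = trans (complement-adj u≢v) (cong not (adjacent u≢v))

  independent⇒sparse : ∀ k {S : Subset n} → (∀ {u v} → u ∈ S → v ∈ S → adj G u v ≡ false) →
                        ∀ {v} → v ∈ S → ∣ S ∩ nbhd G v ∣ ≤ k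
  independent⇒sparse k {S} independent {v} v∈S = subst (_≤ k) (sym (Empty⇒∣p∣≡0 no-neighbour)) z≤n
    where
    no-neighbour : Empty (S ∩ nbhd G v)
    no-neighbour (w , w∈S∩N) with x∈p∩q⁻ S (nbhd G v) w∈S∩N
    ... | w∈S , w∈N with trans (sym (∈-tabulate⁻ (adj G v) w∈N)) (independent v∈S w∈S)
    ...   | ()

  independent⇒SparseSet : ∀ k {j} (P : Subset n) → j ≤ ∣ P ∣ →
                          (∀ {u v} → u ∈ P → v ∈ P → adj G u v ≡ false) → Σ (Subset n) (SparseSet G k j)
  independent⇒SparseSet k P j≤∣P∣ independent with ∃-subset-of-size P _ j≤∣P∣
  ... | S , S⊆P , ∣S∣≡j =
    S , ∣S∣≡j , λ v v∈S → independent⇒sparse k (λ u∈S w∈S → independent (S⊆P u∈S) (S⊆P w∈S)) v∈S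

  closed-degree : ∀ u {P Q : Subset n} → (∀ {v} → v ∈ P → v ∉ Q) →
                  (∀ {v} → v ∈ P → v ≢ u → adj G u v ≡ true) → (∀ {v} → v ∈ Q → adj G u v ≡ true) →
                  ∣ P ∣ + ∣ Q ∣ ≤ suc ∣ nbhd G u ∣
  closed-degree u {P} {Q} disjoint adjacent-in-P adjacent-in-Q = begin
    ∣ P ∣ + ∣ Q ∣                   ≡⟨ ∣p∪q∣+∣p∩q∣≡∣p∣+∣q∣ P Q ⟨
    ∣ P ∪ Q ∣ + ∣ P ∩ Q ∣           ≡⟨ cong (∣ P ∪ Q ∣ +_) (Empty⇒∣p∣≡0 P∩Q-empty) ⟩
    ∣ P ∪ Q ∣ + 0                   ≡⟨ +-identityʳ ∣ P ∪ Q ∣ ⟩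
    ∣ P ∪ Q ∣                       ≤⟨ p⊆q⇒∣p∣≤∣q∣ P∪Q⊆N[u] ⟩
    ∣ nbhd G u ∪ ⁅ u ⁆ ∣            ≤⟨ ∣p∪q∣≤∣p∣+∣q∣ (nbhd G u) ⁅ u ⁆ ⟩
    ∣ nbhd G u ∣ + ∣ ⁅ u ⁆ ∣        ≡⟨ cong (∣ nbhd G u ∣ +_) (∣⁅x⁆∣≡1 u) ⟩
    ∣ nbhd G u ∣ + 1                ≡⟨ +-comm ∣ nbhd G u ∣ 1 ⟩
    suc ∣ nbhd G u ∣                ∎
    where
    open ≤-Reasoning
    P∩Q-empty : Empty (P ∩ Q)
    P∩Q-empty (v , v∈P∩Q) = let v∈P , v∈Q = x∈p∩q⁻ P Q v∈P∩Q in disjoint v∈P v∈Q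
    P∪Q⊆N[u] : P ∪ Q ⊆ nbhd G u ∪ ⁅ u ⁆
    P∪Q⊆N[u] {v} v∈P∪Q with x∈p∪q⁻ P Q v∈P∪Q
    ... | inj₂ v∈Q = x∈p∪q⁺ (inj₁ (∈-tabulate⁺ (adj G u) (adjacent-in-Q v∈Q)))
    ... | inj₁ v∈P with v Fin.≟ u
    ...   | yes refl = x∈p∪q⁺ (inj₂ (x∈⁅x⁆ u))
    ...   | no v≢u = x∈p∪q⁺ (inj₁ (∈-tabulate⁺ (adj G u) (adjacent-in-P v∈P v≢u)))

  no-sparse-set : ∀ {k j} (P : Subset n) → n < j + ∣ P ∣ →
                  (∀ {u} → u ∈ P → n + k < j + ∣ nbhd G u ∣) → ¬ Σ (Subset n) (SparseSet G k j)
  no-sparse-set P n<j+∣P∣ high-degree (S , refl , sparse) =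
    <⇒≱ (n+m<∣p∣+∣q∣⇒m<∣p∩q∣ S (nbhd G u) (high-degree u∈P)) (sparse u u∈S)
    where
    S∩P-nonempty : Nonempty (S ∩ P)
    S∩P-nonempty = 0<∣p∣⇒Nonempty
      (n+m<∣p∣+∣q∣⇒m<∣p∩q∣ S P (subst (_< ∣ S ∣ + ∣ P ∣) (sym (+-identityʳ n)) n<j+∣P∣))
    u = proj₁ S∩P-nonempty
    u∈S = proj₁ (x∈p∩q⁻ S P (proj₂ S∩P-nonempty))
    u∈P = proj₂ (x∈p∩q⁻ S P (proj₂ S∩P-nonempty))

∣p∣≤m⇒n∸m≤∣∁p∣ : ∀ {n m} (p : Subset n) → ∣ p ∣ ≤ m → n ∸ m ≤ ∣ ∁ p ∣
∣p∣≤m⇒n∸m≤∣∁p∣ {n} {m} p ∣p∣≤m = subst (n ∸ m ≤_) (sym (∣∁p∣≡n∸∣p∣ p)) (∸-monoʳ-≤ n ∣p∣≤m)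

∈∁-tabulate⁻ : ∀ {n} (f : Fin n → Bool) {v} → v ∈ ∁ (tabulate f) → f v ≡ false
∈∁-tabulate⁻ f v∈∁ = ¬-not (x∈∁p⇒x∉p v∈∁ ∘ ∈-tabulate⁺ f)

split-upper-bound : ∀ k a b → RamseyProp k (suc a) (suc b) (a + suc b)
split-upper-bound k a b G (C , clique , independent) with suc a ≤? ∣ tabulate C ∣
... | yes 1+a≤∣K∣ = inj₁ (independent⇒SparseSet (complement G) k (tabulate C) 1+a≤∣K∣
        λ u∈K v∈K → complement-nonadjacent G
          λ u≢v → clique _ _ u≢v (∈-tabulate⁻ C u∈K) (∈-tabulate⁻ C v∈K))
... | no 1+a≰∣K∣ = inj₂ (independent⇒SparseSet G k (∁ (tabulate C)) 1+b≤∣I∣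
        λ u∈I v∈I → independent _ _ (∈∁-tabulate⁻ C u∈I) (∈∁-tabulate⁻ C v∈I))
  where
  1+b≤∣I∣ : suc b ≤ ∣ ∁ (tabulate C) ∣
  1+b≤∣I∣ = subst (_≤ ∣ ∁ (tabulate C) ∣) (m+n∸m≡n a (suc b))
              (∣p∣≤m⇒n∸m≤∣∁p∣ (tabulate C) (≤-pred (≰⇒> 1+a≰∣K∣)))

dropFirst : ∀ {n} → Graph (suc n) → Graph n
dropFirst G = record
  { adj    = λ u v → adj G (Fin.suc u) (Fin.suc v)
  ; sym    = λ u v → Graph.sym G (Fin.suc u) (Fin.suc v)
  ; irrefl = irrefl G ∘ Fin.suc
  }

module _ {n} (G : Graph (suc n)) where

  dropFirst-isSplit : IsSplit G → IsSplit (dropFirst G)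
  dropFirst-isSplit (C , clique , independent) =
    C ∘ Fin.suc , (λ u v u≢v → clique _ _ (u≢v ∘ Fin.suc-injective)) , (λ u v → independent _ _)

  complement-dropFirst : ∀ v → nbhd (complement (dropFirst G)) v ≡ nbhd (dropFirst (complement G)) v
  complement-dropFirst v = tabulate-cong λ w →
    cong (λ b → not (adj G (Fin.suc v) (Fin.suc w)) ∧ not b) (sym (⌊⌋-map′ _ _ (v Fin.≟ w)))

  lift-SparseSet : ∀ {k j S} → SparseSet (dropFirst G) k j S → SparseSet G k j (outside ∷ S)
  lift-SparseSet (∣S∣≡j , sparse) = ∣S∣≡j , λ { (Fin.suc v) (there v∈S) → sparse v v∈S }

  lift-DenseSet : ∀ {k i S} → DenseSet (dropFirst G) k i S → DenseSet G k i (outside ∷ S)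
  lift-DenseSet {k} {S = S} (∣S∣≡i , dense) = ∣S∣≡i , λ
    { (Fin.suc v) (there v∈S) → subst (λ N → ∣ S ∩ N ∣ ≤ k) (complement-dropFirst v) (dense v v∈S) }

RamseyProp-suc : ∀ {k i j m} → RamseyProp k i j m → RamseyProp k i j (suc m)
RamseyProp-suc ramsey G split with ramsey (dropFirst G) (dropFirst-isSplit G split)
... | inj₁ (S , dense)  = inj₁ (outside ∷ S , lift-DenseSet G dense)
... | inj₂ (S , sparse) = inj₂ (outside ∷ S , lift-SparseSet G sparse)

RamseyProp-mono : ∀ {k i j m n} → m ≤ n → RamseyProp k i j m → RamseyProp k i j n
RamseyProp-mono = mono′ ∘ ≤⇒≤′
  where
  mono′ : ∀ {k i j m n} → m ≤′ n → RamseyProp k i j m → RamseyProp k i j n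
  mono′ (≤′-reflexive refl) = id
  mono′ (≤′-step m≤′n)      = RamseyProp-suc ∘ mono′ m≤′n

p+1+k≤1+d⇒q+p+k<1+q+d : ∀ p q k d → p + suc k ≤ suc d → q + p + k < suc q + d
p+1+k≤1+d⇒q+p+k<1+q+d p q k d p+1+k≤1+d = s≤s (begin
  q + p + k   ≡⟨ +-assoc q p k ⟩
  q + (p + k) ≤⟨ +-monoʳ-≤ q (s≤s⁻¹ (subst (_≤ suc d) (+-suc p k) p+1+k≤1+d)) ⟩
  q + d       ∎)
  where open ≤-Reasoning

-- Vertices 0, …, a - 1 form the clique and a, …, a + b - 1 the independent set; a clique vertex
-- and an independent vertex are adjacent iff exactly one of them lies in the middle block
-- a - c, …, a + c - 1.
module LowerBound (k a b : ℕ) (2c≤a : suc k + suc k ≤ a) (2c≤b : suc k + suc k ≤ b) where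

  c : ℕ
  c = suc k

  inClique : ℕ → Bool
  inClique x = does (x <? a)

  middle : ℕ → Bool
  middle x = does (a ∸ c ≤? x) ∧ does (x <? a + c)

  joined : ℕ → ℕ → Bool
  joined x y = inClique x ∧ inClique y ∨ (inClique x xor inClique y) ∧ (middle x xor middle y)

  joined-by-sides : ∀ {x y p q} → inClique x ≡ p → inClique y ≡ q →
                    joined x y ≡ p ∧ q ∨ (p xor q) ∧ (middle x xor middle y)
  joined-by-sides refl refl = refl

  joined-sym : ∀ x y → joined x y ≡ joined y x
  joined-sym x y = cong₂ _∨_ (∧-comm (inClique x) (inClique y))
                             (cong₂ _∧_ (xor-comm (inClique x) (inClique y)) (xor-comm (middle x) (middle y)))

  G : Graph (a + b)
  G = record
    { adj    = λ u v → not (isYes (u Fin.≟ v)) ∧ joined (toℕ u) (toℕ v)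
    ; sym    = λ u v → cong₂ (λ e j → not e ∧ j) (isYes-≟-sym u v) (joined-sym (toℕ u) (toℕ v))
    ; irrefl = λ v → cong (λ e → not e ∧ joined (toℕ v) (toℕ v))
                          (trans (isYes≗does (v Fin.≟ v)) (dec-true (v Fin.≟ v) refl))
    }

  inClique-true : ∀ {x} → x < a → inClique x ≡ true
  inClique-true {x} = dec-true (x <? a)

  inClique-false : ∀ {x} → a ≤ x → inClique x ≡ false
  inClique-false {x} a≤x = dec-false (x <? a) (≤⇒≯ a≤x)

  middle-true : ∀ {x} → a ∸ c ≤ x → x < a + c → middle x ≡ true
  middle-true {x} lo≤x x<hi = cong₂ _∧_ (dec-true (a ∸ c ≤? x) lo≤x) (dec-true (x <? a + c) x<hi)

  middle-false-below : ∀ {x} → x < a ∸ c → middle x ≡ false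
  middle-false-below {x} x<lo = cong (_∧ does (x <? a + c)) (dec-false (a ∸ c ≤? x) (<⇒≱ x<lo))

  middle-false-above : ∀ {x} → a + c ≤ x → middle x ≡ false
  middle-false-above {x} hi≤x =
    trans (cong (does (a ∸ c ≤? x) ∧_) (dec-false (x <? a + c) (≤⇒≯ hi≤x))) (∧-zeroʳ _)

  module _ {u v : Fin (a + b)} where

    adj-distinct : u ≢ v → adj G u v ≡ joined (toℕ u) (toℕ v)
    adj-distinct u≢v = cong (λ e → not e ∧ joined (toℕ u) (toℕ v)) (isYes-≟-false u≢v)

    clique-adj : u ≢ v → inClique (toℕ u) ≡ true → inClique (toℕ v) ≡ true → adj G u v ≡ true
    clique-adj u≢v clique-u clique-v = trans (adj-distinct u≢v) (joined-by-sides clique-u clique-v)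

    indep-nonadj : inClique (toℕ u) ≡ false → inClique (toℕ v) ≡ false → adj G u v ≡ false
    indep-nonadj indep-u indep-v =
      trans (cong (not (isYes (u Fin.≟ v)) ∧_) (joined-by-sides indep-u indep-v)) (∧-zeroʳ _)

    cross-adj : inClique (toℕ u) ≡ true → inClique (toℕ v) ≡ false →
                adj G u v ≡ middle (toℕ u) xor middle (toℕ v)
    cross-adj clique-u indep-v = trans (adj-distinct u≢v) (joined-by-sides clique-u indep-v)
      where
      u≢v : u ≢ v
      u≢v refl = contradiction (trans (sym clique-u) indep-v) λ ()

  G-isSplit : IsSplit G
  G-isSplit = inClique ∘ toℕ , (λ u v → clique-adj) , (λ u v → indep-nonadj)

  K I : Subset (a + b)
  K = interval 0 a
  I = interval a b

  c≤a : c ≤ a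
  c≤a = m+n≤o⇒m≤o c 2c≤a

  a∸c+c≡a : a ∸ c + c ≡ a
  a∸c+c≡a = m∸n+n≡m c≤a

  clique-degree-via : ∀ {u} → inClique (toℕ u) ≡ true → (X : Subset (a + b)) → ∣ X ∣ ≡ c →
                      (∀ {v} → v ∈ X → a ≤ toℕ v × middle (toℕ u) xor middle (toℕ v) ≡ true) →
                      a + c ≤ suc ∣ nbhd G u ∣
  clique-degree-via {u} clique-u X ∣X∣≡c X-across =
    subst₂ (λ p q → p + q ≤ suc ∣ nbhd G u ∣) (∣interval∣ 0 a (m≤m+n a b)) ∣X∣≡c
      (closed-degree G u disjoint adjacent-in-K adjacent-in-X)
    where
    disjoint : ∀ {v} → v ∈ K → v ∉ X
    disjoint v∈K v∈X = <⇒≱ (proj₂ (∈-interval⁻ v∈K)) (proj₁ (X-across v∈X))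
    adjacent-in-K : ∀ {v} → v ∈ K → v ≢ u → adj G u v ≡ true
    adjacent-in-K v∈K v≢u = clique-adj (v≢u ∘ sym) clique-u (inClique-true (proj₂ (∈-interval⁻ v∈K)))
    adjacent-in-X : ∀ {v} → v ∈ X → adj G u v ≡ true
    adjacent-in-X v∈X =
      trans (cross-adj clique-u (inClique-false (proj₁ (X-across v∈X)))) (proj₂ (X-across v∈X))

  indep-codegree-via : ∀ {u} → inClique (toℕ u) ≡ false → (X : Subset (a + b)) → ∣ X ∣ ≡ c →
                       (∀ {v} → v ∈ X → toℕ v < a × middle (toℕ v) xor middle (toℕ u) ≡ false) →
                       b + c ≤ suc ∣ nbhd (complement G) u ∣
  indep-codegree-via {u} indep-u X ∣X∣≡c X-along =
    subst₂ (λ p q → p + q ≤ suc ∣ nbhd (complement G) u ∣) (∣interval∣ a b ≤-refl) ∣X∣≡c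
      (closed-degree (complement G) u disjoint adjacent-in-I adjacent-in-X)
    where
    disjoint : ∀ {v} → v ∈ I → v ∉ X
    disjoint v∈I v∈X = <⇒≱ (proj₁ (X-along v∈X)) (proj₁ (∈-interval⁻ v∈I))
    adjacent-in-I : ∀ {v} → v ∈ I → v ≢ u → adj (complement G) u v ≡ true
    adjacent-in-I v∈I v≢u = trans (complement-adj G (v≢u ∘ sym))
      (cong not (indep-nonadj indep-u (inClique-false (proj₁ (∈-interval⁻ v∈I)))))
    adjacent-in-X : ∀ {v} → v ∈ X → adj (complement G) u v ≡ true
    adjacent-in-X {v} v∈X = trans (complement-adj G u≢v) (cong not (begin
      adj G u v                             ≡⟨ Graph.sym G u v ⟩
      adj G v u                             ≡⟨ cross-adj clique-v indep-u ⟩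
      middle (toℕ v) xor middle (toℕ u)    ≡⟨ proj₂ (X-along v∈X) ⟩
      false                                 ∎))
      where
      open ≡-Reasoning
      clique-v = inClique-true (proj₁ (X-along v∈X))
      u≢v : u ≢ v
      u≢v refl = contradiction (trans (sym clique-v) indep-u) λ ()

  clique-degree : ∀ {u} → toℕ u < a → a + c ≤ suc ∣ nbhd G u ∣
  clique-degree {u} u<a = by-middle (middle (toℕ u)) refl
    where
    by-middle : ∀ m → middle (toℕ u) ≡ m → a + c ≤ suc ∣ nbhd G u ∣
    by-middle true middle-u = clique-degree-via (inClique-true u<a) (interval (a + c) c)
      (∣interval∣ (a + c) c (subst (_≤ a + b) (sym (+-assoc a c c)) (+-monoʳ-≤ a 2c≤b)))
      λ v∈X → let a+c≤v = proj₁ (∈-interval⁻ v∈X) in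
        m+n≤o⇒m≤o a a+c≤v , cong₂ _xor_ middle-u (middle-false-above a+c≤v)
    by-middle false middle-u = clique-degree-via (inClique-true u<a) (interval a c)
      (∣interval∣ a c (+-monoʳ-≤ a (m+n≤o⇒m≤o c 2c≤b)))
      λ v∈X → let a≤v , v<a+c = ∈-interval⁻ v∈X in
        a≤v , cong₂ _xor_ middle-u (middle-true (≤-trans (m∸n≤m a c) a≤v) v<a+c)

  indep-codegree : ∀ {u} → a ≤ toℕ u → b + c ≤ suc ∣ nbhd (complement G) u ∣
  indep-codegree {u} a≤u = by-middle (middle (toℕ u)) refl
    where
    by-middle : ∀ m → middle (toℕ u) ≡ m → b + c ≤ suc ∣ nbhd (complement G) u ∣
    by-middle true middle-u = indep-codegree-via (inClique-false a≤u) (interval (a ∸ c) c)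
      (∣interval∣ (a ∸ c) c (≤-trans (≤-reflexive a∸c+c≡a) (m≤m+n a b)))
      λ {v} v∈X → let a∸c≤v , v<a∸c+c = ∈-interval⁻ v∈X
                      v<a = subst (toℕ v <_) a∸c+c≡a v<a∸c+c in
            v<a , cong₂ _xor_ (middle-true a∸c≤v (≤-trans v<a (m≤m+n a c))) middle-u
    by-middle false middle-u = indep-codegree-via (inClique-false a≤u) (interval 0 c)
      (∣interval∣ 0 c (≤-trans c≤a (m≤m+n a b)))
      λ v∈X → let v<c = proj₂ (∈-interval⁻ v∈X) in
        ≤-trans v<c c≤a ,
        cong₂ _xor_ (middle-false-below (≤-trans v<c (m+n≤o⇒m≤o∸n c 2c≤a))) middle-u

  not-Ramsey : ¬ RamseyProp k (suc a) (suc b) (a + b)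
  not-Ramsey ramsey with ramsey G G-isSplit
  ... | inj₁ dense = no-sparse-set (complement G) I
          (subst (a + b <_) (cong (suc a +_) (sym (∣interval∣ a b ≤-refl))) (n<1+n (a + b)))
          (λ u∈I → p+1+k≤1+d⇒q+p+k<1+q+d b a k _ (indep-codegree (proj₁ (∈-interval⁻ u∈I))))
          dense
  ... | inj₂ sparse = no-sparse-set G K
          (subst₂ _<_ (+-comm b a) (cong (suc b +_) (sym (∣interval∣ 0 a (m≤m+n a b)))) (n<1+n (b + a)))
          (λ {u} u∈K → subst (λ n → n + k < suc b + ∣ nbhd G u ∣) (+-comm b a)
                         (p+1+k≤1+d⇒q+p+k<1+q+d a b k _ (clique-degree (proj₂ (∈-interval⁻ u∈K)))))
          sparse

split-Ramsey-number : ∀ k a b → suc k + suc k ≤ a → suc k + suc k ≤ b →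
                      SplitRamseyIs k (suc a) (suc b) (a + suc b)
split-Ramsey-number k a b 2c≤a 2c≤b = split-upper-bound k a b , λ m m<a+1+b →
  LowerBound.not-Ramsey k a b 2c≤a 2c≤b ∘ RamseyProp-mono (s≤s⁻¹ (subst (m <_) (+-suc a b) m<a+1+b))

2k+3≡1+[1+k]+[1+k] : ∀ k → 2 * k + 3 ≡ suc (suc k + suc k)
2k+3≡1+[1+k]+[1+k] = solve-∀

corollary6p1 : (k i j : ℕ) → 2 * k + 3 ≤ i → 2 * k + 3 ≤ j →
    SplitRamseyIs k i j (i + j ∸ 1)
corollary6p1 k i j 2k+3≤i 2k+3≤j = from-bounds (normalise 2k+3≤i) (normalise 2k+3≤j)
  where
  normalise : ∀ {n} → 2 * k + 3 ≤ n → suc (suc k + suc k) ≤ n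
  normalise {n} = subst (_≤ n) (2k+3≡1+[1+k]+[1+k] k)
  from-bounds : ∀ {i j} → suc (suc k + suc k) ≤ i → suc (suc k + suc k) ≤ j →
                SplitRamseyIs k i j (i + j ∸ 1)
  from-bounds {suc a} {suc b} (s≤s 2c≤a) (s≤s 2c≤b) = split-Ramsey-number k a b 2c≤a 2c≤b
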